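{- Let $P$ be a finite bounded poset with a recursive first atom set $\Omega$. Let $[x,y]_r$ be a rooted interval of $P$ and $m$ a maximal chain of $[x,y]_r$. If $m\neq c(r,x,y)$, then $m$ contains a pseudo descent.
   Context: A poset is bounded if it has a unique minimum $\hat 0$ and maximum $\hat 1$; $x\lessdot y$ denotes a cover relation; the length of a chain is one less than its number of elements and the length of $P$ is the length of its longest chain. A root of $x$ is a maximal chain of $[\hat0,x]$; a rooted interval $[x,y]_r$ is an interval with a root $r$ of $x$. For a chain $m$ containing $x$, $m^x=\{w\in m:w\le x\}$; $r\cup a$ means $r\cup\{a\}$. Recursive first atom set (RFAS): $P$ admits an RFAS if $P$ has length 1, or if for each $x<y$ in $P$ and each root $r$ of $x$ there is an atom $\Omega(r,x,y)$ of $[x,y]$ (the first atom of $[x,y]_r$) such that, whenever $a$ is an atom of $[x,y]$ with $a<y$ and $b=\Omega(r\cup a,a,y)$: (i) $a=\Omega(r,x,y)$ if and only if $a=\Omega(r,x,b)$; (ii) if $a\ne\Omega(r,x,y)=:a'$, there exist atoms $a_1,\dots,a_p$ of $[x,y]$ and elements $b_1,\dots,b_{p-1}$ with $a_p=\Omega(r,x,b)$, $a_1=a'$, and for all $1\le i\le p-1$, $b_i=\Omega(r\cup a_{i+1},a_{i+1},y)$ and $a_i=\Omega(r,x,b_i)$. The first atom chain $c(r,x,y)$ is the unique maximal chain $x=z_0\lessdot z_1\lessdot\cdots\lessdot z_q=y$ of $[x,y]$ with $z_{i+1}=\Omega(r\cup\{z_1,\dots,z_i\},z_i,y)$ for $0\le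 i\le q-2$. For a maximal chain $m: x=x_0\lessdot x_1\lessdot\cdots\lessdot x_n=y$ of $[x,y]_r$, a triple $x_i\lessdot x_{i+1}\lessdot x_{i+2}$ is a pseudo descent of $m$ if $x_{i+1}\ne\Omega(r\cup\{x_1,\dots,x_i\},x_i,x_{i+2})$ (for a maximal chain of $P$ this reads $x_{i+1}\ne\Omega(m^{x_i},x_i,x_{i+2})$). -}

module Defs where

open import Data.Nat using (ℕ; zero; suc)
open import Data.Fin using (Fin; zero; suc; fromℕ; inject₁)
open import Data.List using (List; []; _∷_; _++_; [_])
open import Data.Product using (Σ; ∃; _×_; _,_)
open import Data.Sum using (_⊎_)
open import Data.Empty using (⊥)
open import Data.Unit using (⊤)
open import Relation.Nullary using (¬_)
open import Relation.Binary.PropositionalEquality using (_≡_; _≢_)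
open import Relation.Binary.Structures using (IsPartialOrder)
open import Function.Bundles using (_⇔_)

record FinBoundedPoset : Set₁ where
  field
    n              : ℕ
    _≤_            : Fin n → Fin n → Set
    isPartialOrder : IsPartialOrder _≡_ _≤_
    0̂              : Fin n
    1̂              : Fin n
    0̂-min          : ∀ x → 0̂ ≤ x
    1̂-max          : ∀ x → x ≤ 1̂

  Carrier : Set
  Carrier = Fin n

module _ (P : FinBoundedPoset) where
  open FinBoundedPoset P

  _<P_ : Carrier → Carrier → Set
  x <P y = x ≤ y × x ≢ y

  _⋖_ : Carrier → Carrier → Set
  x ⋖ y = x <P y × (∀ z → ¬ (x <P z × z <P y))

  MaxChain : Carrier → Carrier → List Carrier → Set
  MaxChain x y []            = ⊥
  MaxChain x y (z ∷ [])      = z ≡ x × z ≡ y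
  MaxChain x y (z ∷ w ∷ l)   = z ≡ x × z ⋖ w × MaxChain w y (w ∷ l)

  IsRoot : List Carrier → Carrier → Set
  IsRoot r x = MaxChain 0̂ x r

  IsAtom : Carrier → Carrier → Carrier → Set
  IsAtom x y a = x ⋖ a × a ≤ y

  HasLength1 : Set
  HasLength1 = (∃ λ a → ∃ λ b → a <P b) × ¬ (∃ λ a → ∃ λ b → ∃ λ c → a <P b × b <P c)

  -- Ω r x y is the first atom of [x,y]_r; r ∪ a is r ++ [ a ].
  FirstAtomMap : Set
  FirstAtomMap = List Carrier → Carrier → Carrier → Carrier

  ConditionII : FirstAtomMap → List Carrier → Carrier → Carrier → Carrier → Set
  ConditionII Ω r x y a =
    Σ ℕ λ k →                           -- p = k + 1
    Σ (Fin (suc k) → Carrier) λ as →    -- a₁ … a_p  (as i = a_{i+1})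
    Σ (Fin k → Carrier) λ bs →          -- b₁ … b_{p-1}
      (∀ i → IsAtom x y (as i))
      × as (fromℕ k) ≡ Ω r x (Ω (r ++ [ a ]) a y)
      × as zero ≡ Ω r x y
      × (∀ (i : Fin k) →
           bs i ≡ Ω (r ++ [ as (suc i) ]) (as (suc i)) y
           × as (inject₁ i) ≡ Ω r x (bs i))

  IsRFAS : FirstAtomMap → Set
  IsRFAS Ω =
    HasLength1 ⊎
    (∀ x y r → x <P y → IsRoot r x →
       IsAtom x y (Ω r x y)
       × (∀ a → IsAtom x y a → a <P y →
            (a ≡ Ω r x y ⇔ a ≡ Ω r x (Ω (r ++ [ a ]) a y))
            × (a ≢ Ω r x y → ConditionII Ω r x y a)))

  FirstAtomCond : FirstAtomMap → Carrier → List Carrier → List Carrier → Set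
  FirstAtomCond Ω y r (z ∷ w ∷ w' ∷ l) =
    w ≡ Ω r z y × FirstAtomCond Ω y (r ++ [ w ]) (w ∷ w' ∷ l)
  FirstAtomCond Ω y r _ = ⊤

  IsFirstAtomChain : FirstAtomMap → List Carrier → Carrier → Carrier → List Carrier → Set
  IsFirstAtomChain Ω r x y c = MaxChain x y c × FirstAtomCond Ω y r c

  HasPseudoDescent : FirstAtomMap → List Carrier → List Carrier → Set
  HasPseudoDescent Ω r (z ∷ w ∷ w' ∷ l) =
    (w ≢ Ω r z w') ⊎ HasPseudoDescent Ω (r ++ [ w ]) (w ∷ w' ∷ l)
  HasPseudoDescent Ω r _ = ⊥

module Submission where

open import Defs
open import Data.Fin.Properties using (_≟_)
open import Data.List using (List; []; _∷_; _++_; [_])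
open import Data.Product using (_,_; proj₁; proj₂)
open import Data.Sum using (inj₁; inj₂)
open import Function.Bundles using (Equivalence)
open import Relation.Binary.Construct.NonStrictToStrict using (<-≤-trans; <-irrefl)
open import Relation.Binary.PropositionalEquality using (_≡_; _≢_; refl; sym; cong; subst)
open import Relation.Binary.Structures using (IsPartialOrder)
open import Relation.Nullary using (¬_; Dec; no; contradiction)
open import Relation.Nullary.Decidable using (¬?; _⊎-dec_; decidable-stable)

-- Without a pseudo descent each step x_{i+1} = Ω (r ∪ …) x_i x_{i+2} of m can be
-- pushed, from the top of the chain downwards, to x_{i+1} = Ω (r ∪ …) x_i y by
-- condition (i) of the RFAS; so m satisfies the recursion defining c(r,x,y),
-- which determines a maximal chain uniquely.

module _ (P : FinBoundedPoset) where
  open FinBoundedPoset P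
  open IsPartialOrder isPartialOrder using (antisym; ≤-respʳ-≈) renaming (refl to ≤-refl; trans to ≤-trans)

  <P-≤-trans : ∀ {a b c} → _<P_ P a b → b ≤ c → _<P_ P a c
  <P-≤-trans = <-≤-trans _≡_ _≤_ sym ≤-trans antisym ≤-respʳ-≈

  maxChain⇒≤ : ∀ {x y} m → MaxChain P x y m → x ≤ y
  maxChain⇒≤ (z ∷ [])    (refl , refl)                 = ≤-refl
  maxChain⇒≤ (z ∷ w ∷ l) (refl , ((z≤w , _) , _) , mc) = ≤-trans z≤w (maxChain⇒≤ (w ∷ l) mc)

  maxChain⇒< : ∀ {x y} z w l → MaxChain P x y (z ∷ w ∷ l) → _<P_ P x y
  maxChain⇒< z w l (refl , (z<w , _) , mc) = <P-≤-trans z<w (maxChain⇒≤ (w ∷ l) mc)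

  maxChain-refl : ∀ {x} m → MaxChain P x x m → m ≡ [ x ]
  maxChain-refl (z ∷ [])    (refl , refl) = refl
  maxChain-refl (z ∷ w ∷ l) mc            = contradiction (maxChain⇒< z w l mc) (<-irrefl _≡_ _≤_ refl)

  maxChain-⋖ : ∀ {x y} m → _⋖_ P x y → MaxChain P x y m → m ≡ x ∷ y ∷ []
  maxChain-⋖ (z ∷ [])         ((_ , x≢y) , _)  (refl , refl)            = contradiction refl x≢y
  maxChain-⋖ (z ∷ w ∷ [])     _                (refl , _ , refl , refl) = refl
  maxChain-⋖ (z ∷ w ∷ w′ ∷ l) (_ , no-between) (refl , (z<w , _) , mc)  =
    contradiction (z<w , maxChain⇒< w w′ l mc) (no-between w)

  maxChain-snoc : ∀ {a x x′} r → MaxChain P a x r → _⋖_ P x x′ → MaxChain P a x′ (r ++ [ x′ ])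
  maxChain-snoc (z ∷ [])    (refl , refl)     x⋖x′ = refl , x⋖x′ , refl , refl
  maxChain-snoc (z ∷ w ∷ l) (refl , z⋖w , mc) x⋖x′ = refl , z⋖w , maxChain-snoc (w ∷ l) mc x⋖x′

  firstAtomCond-unique : ∀ {Ω x y} r m c → MaxChain P x y m → MaxChain P x y c →
                         FirstAtomCond P Ω y r m → FirstAtomCond P Ω y r c → m ≡ c
  firstAtomCond-unique r (z ∷ [])     c (refl , refl)              mc′ _ _ = sym (maxChain-refl c mc′)
  firstAtomCond-unique r (z ∷ w ∷ []) c (refl , z⋖w , refl , refl) mc′ _ _ = sym (maxChain-⋖ c z⋖w mc′)
  firstAtomCond-unique r m (z ∷ [])     mc (refl , refl)              _ _ = maxChain-refl m mc
  firstAtomCond-unique r m (z ∷ w ∷ []) mc (refl , z⋖w , refl , refl) _ _ = maxChain-⋖ m z⋖w mc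
  firstAtomCond-unique r (z ∷ w ∷ w₂ ∷ l) (.z ∷ .w ∷ w₂′ ∷ l′)
                       (refl , _ , mc) (refl , _ , mc′) (refl , fm) (refl , fc) =
    cong (z ∷_) (firstAtomCond-unique (r ++ [ w ]) (w ∷ w₂ ∷ l) (w ∷ w₂′ ∷ l′) mc mc′ fm fc)

  module _ (Ω : FirstAtomMap P) where

    hasPseudoDescent? : ∀ r m → Dec (HasPseudoDescent P Ω r m)
    hasPseudoDescent? r (z ∷ w ∷ w′ ∷ l) =
      ¬? (w ≟ Ω r z w′) ⊎-dec hasPseudoDescent? (r ++ [ w ]) (w ∷ w′ ∷ l)
    hasPseudoDescent? r []           = no λ ()
    hasPseudoDescent? r (_ ∷ [])     = no λ ()
    hasPseudoDescent? r (_ ∷ _ ∷ []) = no λ ()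

    firstAtom-lift : IsRFAS P Ω → ∀ {r z w y} → IsRoot P r z → _⋖_ P z w → _<P_ P w y →
                     w ≡ Ω r z (Ω (r ++ [ w ]) w y) → w ≡ Ω r z y
    firstAtom-lift (inj₁ (_ , no-3-chain)) {z = z} {w} {y} _ (z<w , _) w<y _ =
      contradiction (z , w , y , z<w , w<y) no-3-chain
    firstAtom-lift (inj₂ rfas) rt z⋖w@(z<w , _) w<y =
      Equivalence.from (proj₁ (proj₂ (rfas _ _ _ (<P-≤-trans z<w (proj₁ w<y)) rt) _ (z⋖w , proj₁ w<y) w<y))

    firstAtomCond-head : IsRFAS P Ω → ∀ {r z w w′ y} l → IsRoot P r z → _⋖_ P z w →
                         MaxChain P w y (w ∷ w′ ∷ l) → FirstAtomCond P Ω y (r ++ [ w ]) (w ∷ w′ ∷ l) →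
                         w ≡ Ω r z w′ → w ≡ Ω r z y
    firstAtomCond-head _    []       _  _   (_ , _ , refl , refl) _          w≡Ω = w≡Ω
    firstAtomCond-head rfas (w″ ∷ l) rt z⋖w mc                    (w′≡Ω , _) w≡Ω =
      firstAtom-lift rfas rt z⋖w (maxChain⇒< _ _ (w″ ∷ l) mc) (subst (λ t → _ ≡ Ω _ _ t) w′≡Ω w≡Ω)

    ¬pseudoDescent⇒firstAtomCond : IsRFAS P Ω → ∀ {x y} r m → MaxChain P x y m → IsRoot P r x →
                                   ¬ HasPseudoDescent P Ω r m → FirstAtomCond P Ω y r m
    ¬pseudoDescent⇒firstAtomCond rfas r (z ∷ w ∷ w′ ∷ l) (refl , z⋖w , mc) rt no-pd =
      let tail = ¬pseudoDescent⇒firstAtomCond rfas (r ++ [ w ]) (w ∷ w′ ∷ l) mc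
                   (maxChain-snoc r rt z⋖w) (λ pd → no-pd (inj₂ pd))
          step = decidable-stable (w ≟ Ω r z w′) (λ w≢ → no-pd (inj₁ w≢))
      in firstAtomCond-head rfas l rt z⋖w mc tail step , tail
    ¬pseudoDescent⇒firstAtomCond _ r []           _ _ _ = _
    ¬pseudoDescent⇒firstAtomCond _ r (_ ∷ [])     _ _ _ = _
    ¬pseudoDescent⇒firstAtomCond _ r (_ ∷ _ ∷ []) _ _ _ = _

proposition5p7 : (P : FinBoundedPoset) (Ω : FirstAtomMap P) → IsRFAS P Ω →
    (x y : FinBoundedPoset.Carrier P) (r : List (FinBoundedPoset.Carrier P)) →
    FinBoundedPoset._≤_ P x y → IsRoot P r x →
    (m : List (FinBoundedPoset.Carrier P)) → MaxChain P x y m →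
    (c : List (FinBoundedPoset.Carrier P)) → IsFirstAtomChain P Ω r x y c →
    m ≢ c → HasPseudoDescent P Ω r m
proposition5p7 P Ω rfas x y r _ rt m mc c (cc , fc) m≢c =
  decidable-stable (hasPseudoDescent? P Ω r m) λ no-pd →
    m≢c (firstAtomCond-unique P r m c mc cc (¬pseudoDescent⇒firstAtomCond P Ω rfas r m mc rt no-pd) fc)
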